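{- Let $B\ge 2$ and $D\in\mathbb{Z}[i]\setminus\{0\}$. If there exists a $D$-consecutive sequence of Gaussian $B$-happy numbers of length $m$, then for each $D'\in\{ -D,\ iD,\ -iD,\ \overline{D},\ -\overline{D},\ i\overline{D},\ -i\overline{D}\}$ there exists a $D'$-consecutive sequence of Gaussian $B$-happy numbers of length $m$.
   Context: Fix an integer $B\ge 2$. Every nonzero Gaussian integer $a+bi$ is written uniquely as $a+bi=\sum_{j=0}^n (a_j+b_ji)B^j$ with $a_j,b_j\in\mathbb{Z}$, $a_n,b_n$ not both $0$, and for each $j$: $|a_j|\le B-1$, $|b_j|\le B-1$, $\operatorname{sgn}(a)a_j\ge 0$, $\operatorname{sgn}(b)b_j\ge 0$. The Gaussian $B$-happy function $S_B:\mathbb{Z}[i]\to\mathbb{Z}[i]$ is defined by $S_B(0)=0$ and $S_B(a+bi)=\sum_{j=0}^n (a_j+b_ji)^2$. A Gaussian integer $z$ is Gaussian $B$-happy if $S_B^k(z)=1$ for some $k\ge1$. For $D\in\mathbb{Z}[i]\setminus\{0\}$, a $D$-consecutive sequence of length $m$ is a sequence $z,z+D,\dots,z+(m-1)D$ with $z\in\mathbb{Z}[i]$. -}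

module Defs where

open import Data.Nat as ℕ using (ℕ; zero; suc; NonZero)
open import Data.Nat.DivMod using (_/_; _%_)
open import Data.Integer as ℤ using (ℤ; +_; -[1+_]; ∣_∣)
open import Data.List using (List; []; _∷_; map)
open import Data.Product using (_×_; _,_; ∃; Σ; proj₁; proj₂)
open import Relation.Binary.PropositionalEquality using (_≡_)
open import Relation.Nullary using (¬_)

record ℤ[i] : Set where
  constructor _+_i
  field
    re : ℤ
    im : ℤ
open ℤ[i] public

0ᵍ 1ᵍ : ℤ[i]
0ᵍ = (+ 0) + (+ 0) i
1ᵍ = (+ 1) + (+ 0) i

_+ᵍ_ : ℤ[i] → ℤ[i] → ℤ[i]
(a + b i) +ᵍ (c + d i) = (a ℤ.+ c) + (b ℤ.+ d) i

_*ᵍ_ : ℤ[i] → ℤ[i] → ℤ[i]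
(a + b i) *ᵍ (c + d i) = (a ℤ.* c ℤ.- b ℤ.* d) + (a ℤ.* d ℤ.+ b ℤ.* c) i

-ᵍ_ : ℤ[i] → ℤ[i]
-ᵍ (a + b i) = (ℤ.- a) + (ℤ.- b) i

conj : ℤ[i] → ℤ[i]
conj (a + b i) = a + (ℤ.- b) i

iᵍ : ℤ[i]
iᵍ = (+ 0) + (+ 1) i

_·ᵍ_ : ℕ → ℤ[i] → ℤ[i]
k ·ᵍ (a + b i) = ((+ k) ℤ.* a) + ((+ k) ℤ.* b) i

-- Base-B digits (least significant first) of a natural number n, using fuel.
-- With fuel ≥ n and B ≥ 2 this is the full standard expansion.
digitsFuel : (B : ℕ) → .{{NonZero B}} → ℕ → ℕ → List ℕ
digitsFuel B zero    n = []
digitsFuel B (suc f) zero = []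
digitsFuel B (suc f) n@(suc _) = (n % B) ∷ digitsFuel B f (n / B)

digitsℕ : (B : ℕ) → .{{NonZero B}} → ℕ → List ℕ
digitsℕ B n = digitsFuel B n n

-- Signed digits of an integer a: digits of |a| carrying the sign of a,
-- so that |a_j| ≤ B-1 and sgn(a) a_j ≥ 0.
digitsℤ : (B : ℕ) → .{{NonZero B}} → ℤ → List ℤ
digitsℤ B (+ n)     = map +_ (digitsℕ B n)
digitsℤ B -[1+ n ]  = map (λ d → ℤ.- (+ d)) (digitsℕ B (suc n))

zipPad : List ℤ → List ℤ → List ℤ[i]
zipPad []       []       = []
zipPad []       (b ∷ bs) = ((+ 0) + b i) ∷ zipPad [] bs
zipPad (a ∷ as) []       = (a + (+ 0) i) ∷ zipPad as []
zipPad (a ∷ as) (b ∷ bs) = (a + b i) ∷ zipPad as bs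

gdigits : (B : ℕ) → .{{NonZero B}} → ℤ[i] → List ℤ[i]
gdigits B (a + b i) = zipPad (digitsℤ B a) (digitsℤ B b)

sumᵍ : List ℤ[i] → ℤ[i]
sumᵍ []       = 0ᵍ
sumᵍ (z ∷ zs) = z +ᵍ sumᵍ zs

S : (B : ℕ) → .{{NonZero B}} → ℤ[i] → ℤ[i]
S B z = sumᵍ (map (λ d → d *ᵍ d) (gdigits B z))

iter : {A : Set} → ℕ → (A → A) → A → A
iter zero    f x = x
iter (suc k) f x = f (iter k f x)

Happy : (B : ℕ) → .{{NonZero B}} → ℤ[i] → Set
Happy B z = ∃ λ k → iter (suc k) (S B) z ≡ 1ᵍ

HasConsecHappy : (B : ℕ) → .{{NonZero B}} → ℤ[i] → ℕ → Set
HasConsecHappy B D m = ∃ λ z → ∀ k → k ℕ.< m → Happy B (z +ᵍ (k ·ᵍ D))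

{-# OPTIONS --safe #-}
-- Negation, conjugation and multiplication by i act on a Gaussian integer
-- digitwise, hence S_B(-z) = S_B(z), S_B(conj z) = conj S_B(z) and
-- S_B(iz) = -S_B(z). So S_B(S_B(iz)) = S_B(S_B(z)), and happiness is
-- invariant under all three maps; being additive, they carry D-consecutive
-- happy sequences to f(D)-consecutive ones, and each D' is a composite of them.
module Submission where

open import Defs
open import Data.Nat using (ℕ; _≤_; NonZero; zero; suc; s≤s)
open import Data.Integer as ℤ using (ℤ; +_; -[1+_])
open import Data.Integer.Properties using (neg-involutive; neg-distrib-+)
open import Data.Integer.Tactic.RingSolver using (solve-∀)
open import Data.List using ([]; _∷_; map)
open import Data.List.Properties using (map-id; map-cong; map-∘)
open import Data.Product using (_×_; _,_)
open import Function using (_∘_; id)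
open import Relation.Binary.PropositionalEquality
  using (_≡_; refl; sym; trans; cong; cong₂; subst; module ≡-Reasoning)
open import Relation.Nullary using (¬_)

open ≡-Reasoning

≡ᵍ : ∀ {a b c d} → a ≡ c → b ≡ d → (a + b i) ≡ (c + d i)
≡ᵍ = cong₂ _+_i

sq : ℤ[i] → ℤ[i]
sq d = d *ᵍ d

transpose : ℤ[i] → ℤ[i]
transpose (a + b i) = b + a i

iter-suc : {A : Set} (k : ℕ) (f : A → A) (x : A) → iter (suc k) f x ≡ iter k f (f x)
iter-suc zero    f x = refl
iter-suc (suc k) f x = cong f (iter-suc k f x)

iter-commute : {A : Set} {f h : A → A} → (∀ x → f (h x) ≡ h (f x)) →
               ∀ k x → iter k f (h x) ≡ h (iter k f x)
iter-commute           comm zero    x = refl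
iter-commute {f = f} comm (suc k) x = trans (cong f (iter-commute comm k x)) (comm (iter k f x))

sumᵍ-map-hom : (g : ℤ[i] → ℤ[i]) → g 0ᵍ ≡ 0ᵍ → (∀ x y → g (x +ᵍ y) ≡ g x +ᵍ g y) →
               ∀ zs → sumᵍ (map g zs) ≡ g (sumᵍ zs)
sumᵍ-map-hom g g0 g+ []       = sym g0
sumᵍ-map-hom g g0 g+ (z ∷ zs) =
  trans (cong (g z +ᵍ_) (sumᵍ-map-hom g g0 g+ zs)) (sym (g+ z (sumᵍ zs)))

zipPad-map : (f g : ℤ → ℤ) → f (+ 0) ≡ + 0 → g (+ 0) ≡ + 0 → ∀ as bs →
             zipPad (map f as) (map g bs) ≡ map (λ d → f (re d) + g (im d) i) (zipPad as bs)
zipPad-map f g f0 g0 []       []       = refl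
zipPad-map f g f0 g0 []       (b ∷ bs) = cong₂ _∷_ (≡ᵍ (sym f0) refl) (zipPad-map f g f0 g0 [] bs)
zipPad-map f g f0 g0 (a ∷ as) []       = cong₂ _∷_ (≡ᵍ refl (sym g0)) (zipPad-map f g f0 g0 as [])
zipPad-map f g f0 g0 (a ∷ as) (b ∷ bs) = cong (_ ∷_) (zipPad-map f g f0 g0 as bs)

zipPad-comm : ∀ as bs → zipPad bs as ≡ map transpose (zipPad as bs)
zipPad-comm []       []       = refl
zipPad-comm []       (b ∷ bs) = cong (_ ∷_) (zipPad-comm [] bs)
zipPad-comm (a ∷ as) []       = cong (_ ∷_) (zipPad-comm as [])
zipPad-comm (a ∷ as) (b ∷ bs) = cong (_ ∷_) (zipPad-comm as bs)

iᵍ*-as-transpose : ∀ z → iᵍ *ᵍ z ≡ transpose (conj z)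
iᵍ*-as-transpose (a + b i) = ≡ᵍ (re-eq a b) (im-eq a b)
  where
  re-eq : ∀ a b → (+ 0) ℤ.* a ℤ.- (+ 1) ℤ.* b ≡ ℤ.- b
  re-eq = solve-∀
  im-eq : ∀ a b → (+ 0) ℤ.* b ℤ.+ (+ 1) ℤ.* a ≡ a
  im-eq = solve-∀

sq-neg : ∀ d → sq (-ᵍ d) ≡ sq d
sq-neg (a + b i) = ≡ᵍ (re-eq a b) (im-eq a b)
  where
  re-eq : ∀ a b → (ℤ.- a) ℤ.* (ℤ.- a) ℤ.- (ℤ.- b) ℤ.* (ℤ.- b) ≡ a ℤ.* a ℤ.- b ℤ.* b
  re-eq = solve-∀
  im-eq : ∀ a b → (ℤ.- a) ℤ.* (ℤ.- b) ℤ.+ (ℤ.- b) ℤ.* (ℤ.- a) ≡ a ℤ.* b ℤ.+ b ℤ.* a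
  im-eq = solve-∀

sq-conj : ∀ d → sq (conj d) ≡ conj (sq d)
sq-conj (a + b i) = ≡ᵍ (re-eq a b) (im-eq a b)
  where
  re-eq : ∀ a b → a ℤ.* a ℤ.- (ℤ.- b) ℤ.* (ℤ.- b) ≡ a ℤ.* a ℤ.- b ℤ.* b
  re-eq = solve-∀
  im-eq : ∀ a b → a ℤ.* (ℤ.- b) ℤ.+ (ℤ.- b) ℤ.* a ≡ ℤ.- (a ℤ.* b ℤ.+ b ℤ.* a)
  im-eq = solve-∀

sq-iᵍ* : ∀ d → sq (iᵍ *ᵍ d) ≡ -ᵍ (sq d)
sq-iᵍ* d = trans (cong sq (iᵍ*-as-transpose d)) (sq-transpose-conj d)
  where
  sq-transpose-conj : ∀ d → sq (transpose (conj d)) ≡ -ᵍ (sq d)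
  sq-transpose-conj (a + b i) = ≡ᵍ (re-eq a b) (im-eq a b)
    where
    re-eq : ∀ a b → (ℤ.- b) ℤ.* (ℤ.- b) ℤ.- a ℤ.* a ≡ ℤ.- (a ℤ.* a ℤ.- b ℤ.* b)
    re-eq = solve-∀
    im-eq : ∀ a b → (ℤ.- b) ℤ.* a ℤ.+ a ℤ.* (ℤ.- b) ≡ ℤ.- (a ℤ.* b ℤ.+ b ℤ.* a)
    im-eq = solve-∀

conj-+ᵍ : ∀ x y → conj (x +ᵍ y) ≡ conj x +ᵍ conj y
conj-+ᵍ x y = ≡ᵍ refl (neg-distrib-+ (im x) (im y))

-ᵍ-+ᵍ : ∀ x y → -ᵍ (x +ᵍ y) ≡ (-ᵍ x) +ᵍ (-ᵍ y)
-ᵍ-+ᵍ x y = ≡ᵍ (neg-distrib-+ (re x) (re y)) (neg-distrib-+ (im x) (im y))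

module _ (B : ℕ) .{{_ : NonZero B}} where

  digitsℤ-neg : ∀ a → digitsℤ B (ℤ.- a) ≡ map ℤ.-_ (digitsℤ B a)
  digitsℤ-neg (+ zero)  = refl
  digitsℤ-neg (+ suc n) = map-∘ (digitsℕ B (suc n))
  digitsℤ-neg -[1+ n ]  =
    trans (map-cong (λ d → sym (neg-involutive (+ d))) (digitsℕ B (suc n))) (map-∘ (digitsℕ B (suc n)))

  gdigits-neg : ∀ z → gdigits B (-ᵍ z) ≡ map -ᵍ_ (gdigits B z)
  gdigits-neg (a + b i) = begin
    zipPad (digitsℤ B (ℤ.- a)) (digitsℤ B (ℤ.- b))
      ≡⟨ cong₂ zipPad (digitsℤ-neg a) (digitsℤ-neg b) ⟩
    zipPad (map ℤ.-_ (digitsℤ B a)) (map ℤ.-_ (digitsℤ B b))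
      ≡⟨ zipPad-map ℤ.-_ ℤ.-_ refl refl (digitsℤ B a) (digitsℤ B b) ⟩
    map -ᵍ_ (zipPad (digitsℤ B a) (digitsℤ B b)) ∎

  gdigits-conj : ∀ z → gdigits B (conj z) ≡ map conj (gdigits B z)
  gdigits-conj (a + b i) = begin
    zipPad (digitsℤ B a) (digitsℤ B (ℤ.- b))
      ≡⟨ cong₂ zipPad (sym (map-id (digitsℤ B a))) (digitsℤ-neg b) ⟩
    zipPad (map id (digitsℤ B a)) (map ℤ.-_ (digitsℤ B b))
      ≡⟨ zipPad-map id ℤ.-_ refl refl (digitsℤ B a) (digitsℤ B b) ⟩
    map conj (zipPad (digitsℤ B a) (digitsℤ B b)) ∎

  gdigits-transpose : ∀ z → gdigits B (transpose z) ≡ map transpose (gdigits B z)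
  gdigits-transpose (a + b i) = zipPad-comm (digitsℤ B a) (digitsℤ B b)

  gdigits-iᵍ* : ∀ z → gdigits B (iᵍ *ᵍ z) ≡ map (iᵍ *ᵍ_) (gdigits B z)
  gdigits-iᵍ* z = begin
    gdigits B (iᵍ *ᵍ z)                      ≡⟨ cong (gdigits B) (iᵍ*-as-transpose z) ⟩
    gdigits B (transpose (conj z))           ≡⟨ gdigits-transpose (conj z) ⟩
    map transpose (gdigits B (conj z))       ≡⟨ cong (map transpose) (gdigits-conj z) ⟩
    map transpose (map conj (gdigits B z))   ≡⟨ map-∘ (gdigits B z) ⟨
    map (transpose ∘ conj) (gdigits B z)     ≡⟨ map-cong (sym ∘ iᵍ*-as-transpose) (gdigits B z) ⟩
    map (iᵍ *ᵍ_) (gdigits B z)               ∎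

  S-digitwise : (f g : ℤ[i] → ℤ[i]) → (∀ d → sq (f d) ≡ g (sq d)) →
                g 0ᵍ ≡ 0ᵍ → (∀ x y → g (x +ᵍ y) ≡ g x +ᵍ g y) →
                ∀ z → gdigits B (f z) ≡ map f (gdigits B z) → S B (f z) ≡ g (S B z)
  S-digitwise f g sq-f g0 g+ z digits-f = begin
    sumᵍ (map sq (gdigits B (f z)))      ≡⟨ cong (sumᵍ ∘ map sq) digits-f ⟩
    sumᵍ (map sq (map f ds))             ≡⟨ cong sumᵍ (map-∘ ds) ⟨
    sumᵍ (map (sq ∘ f) ds)               ≡⟨ cong sumᵍ (map-cong sq-f ds) ⟩
    sumᵍ (map (g ∘ sq) ds)               ≡⟨ cong sumᵍ (map-∘ ds) ⟩
    sumᵍ (map g (map sq ds))             ≡⟨ sumᵍ-map-hom g g0 g+ (map sq ds) ⟩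
    g (S B z)                            ∎
    where ds = gdigits B z

  S-neg : ∀ z → S B (-ᵍ z) ≡ S B z
  S-neg z = S-digitwise -ᵍ_ id sq-neg refl (λ _ _ → refl) z (gdigits-neg z)

  S-conj : ∀ z → S B (conj z) ≡ conj (S B z)
  S-conj z = S-digitwise conj conj sq-conj refl conj-+ᵍ z (gdigits-conj z)

  S-iᵍ* : ∀ z → S B (iᵍ *ᵍ z) ≡ -ᵍ (S B z)
  S-iᵍ* z = S-digitwise (iᵍ *ᵍ_) -ᵍ_ sq-iᵍ* refl -ᵍ-+ᵍ z (gdigits-iᵍ* z)

  Happy-S⁻¹ : ∀ {z} → Happy B (S B z) → Happy B z
  Happy-S⁻¹ {z} (k , p) = suc k , trans (iter-suc (suc k) (S B) z) p

  Happy-S : S B 1ᵍ ≡ 1ᵍ → ∀ {z} → Happy B z → Happy B (S B z)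
  Happy-S S1     (zero  , p) = zero , trans (cong (S B) p) S1
  Happy-S S1 {z} (suc k , p) = k , trans (sym (iter-suc (suc k) (S B) z)) p

  Happy-conj : ∀ {z} → Happy B z → Happy B (conj z)
  Happy-conj {z} (k , p) = k , trans (iter-commute {f = S B} {h = conj} S-conj (suc k) z) (cong conj p)

  module _ (S1 : S B 1ᵍ ≡ 1ᵍ) where

    Happy-neg : ∀ {z} → Happy B z → Happy B (-ᵍ z)
    Happy-neg {z} h = Happy-S⁻¹ (subst (Happy B) (sym (S-neg z)) (Happy-S S1 h))

    Happy-iᵍ* : ∀ {z} → Happy B z → Happy B (iᵍ *ᵍ z)
    Happy-iᵍ* {z} h = Happy-S⁻¹ (subst (Happy B) (sym (S-iᵍ* z)) (Happy-neg (Happy-S S1 h)))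

  HasConsecHappy-map : (f : ℤ[i] → ℤ[i]) → (∀ {z} → Happy B z → Happy B (f z)) →
                       (∀ z k D → f (z +ᵍ (k ·ᵍ D)) ≡ f z +ᵍ (k ·ᵍ f D)) →
                       ∀ {D m} → HasConsecHappy B D m → HasConsecHappy B (f D) m
  HasConsecHappy-map f happy-f f-affine {D} (z , h) =
    f z , λ k k<m → subst (Happy B) (f-affine z k D) (happy-f (h k k<m))

S-1ᵍ : (B : ℕ) .{{_ : NonZero B}} → 2 ≤ B → S B 1ᵍ ≡ 1ᵍ
S-1ᵍ (suc (suc _)) _       = refl
S-1ᵍ (suc zero)    (s≤s ())

-ᵍ-affine : ∀ z k D → -ᵍ (z +ᵍ (k ·ᵍ D)) ≡ (-ᵍ z) +ᵍ (k ·ᵍ (-ᵍ D))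
-ᵍ-affine (a + b i) k (c + d i) = ≡ᵍ (neg-affine a (+ k) c) (neg-affine b (+ k) d)
  where
  neg-affine : ∀ a n c → ℤ.- (a ℤ.+ n ℤ.* c) ≡ (ℤ.- a) ℤ.+ n ℤ.* (ℤ.- c)
  neg-affine = solve-∀

conj-affine : ∀ z k D → conj (z +ᵍ (k ·ᵍ D)) ≡ conj z +ᵍ (k ·ᵍ conj D)
conj-affine z k D = ≡ᵍ refl (cong im (-ᵍ-affine z k D))

iᵍ*-affine : ∀ z k D → iᵍ *ᵍ (z +ᵍ (k ·ᵍ D)) ≡ (iᵍ *ᵍ z) +ᵍ (k ·ᵍ (iᵍ *ᵍ D))
iᵍ*-affine (a + b i) k (c + d i) = ≡ᵍ (re-eq a b c d (+ k)) (im-eq a b c d (+ k))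
  where
  re-eq : ∀ a b c d n → (+ 0) ℤ.* (a ℤ.+ n ℤ.* c) ℤ.- (+ 1) ℤ.* (b ℤ.+ n ℤ.* d)
                      ≡ ((+ 0) ℤ.* a ℤ.- (+ 1) ℤ.* b) ℤ.+ n ℤ.* ((+ 0) ℤ.* c ℤ.- (+ 1) ℤ.* d)
  re-eq = solve-∀
  im-eq : ∀ a b c d n → (+ 0) ℤ.* (b ℤ.+ n ℤ.* d) ℤ.+ (+ 1) ℤ.* (a ℤ.+ n ℤ.* c)
                      ≡ ((+ 0) ℤ.* b ℤ.+ (+ 1) ℤ.* a) ℤ.+ n ℤ.* ((+ 0) ℤ.* d ℤ.+ (+ 1) ℤ.* c)
  im-eq = solve-∀

lemma14 : (B : ℕ) → .{{_ : NonZero B}} → 2 ≤ B → (D : ℤ[i]) → ¬ (D ≡ 0ᵍ) →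
            (m : ℕ) → HasConsecHappy B D m →
            HasConsecHappy B (-ᵍ D) m × HasConsecHappy B (iᵍ *ᵍ D) m
              × HasConsecHappy B (-ᵍ (iᵍ *ᵍ D)) m × HasConsecHappy B (conj D) m
              × HasConsecHappy B (-ᵍ (conj D)) m × HasConsecHappy B (iᵍ *ᵍ conj D) m
              × HasConsecHappy B (-ᵍ (iᵍ *ᵍ conj D)) m
lemma14 B 2≤B D _ m H = neg H , rot H , neg (rot H) , cj H , neg (cj H) , rot (cj H) , neg (rot (cj H))
  where
  S1 : S B 1ᵍ ≡ 1ᵍ
  S1 = S-1ᵍ B 2≤B
  neg : ∀ {E} → HasConsecHappy B E m → HasConsecHappy B (-ᵍ E) m
  neg = HasConsecHappy-map B -ᵍ_ (Happy-neg B S1) -ᵍ-affine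
  rot : ∀ {E} → HasConsecHappy B E m → HasConsecHappy B (iᵍ *ᵍ E) m
  rot = HasConsecHappy-map B (iᵍ *ᵍ_) (Happy-iᵍ* B S1) iᵍ*-affine
  cj : ∀ {E} → HasConsecHappy B E m → HasConsecHappy B (conj E) m
  cj = HasConsecHappy-map B conj (Happy-conj B) conj-affine
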